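{- Let $n\geq 2$ and let $\mathcal{G}$ be a graph that is the union of $n$ cliques $Q_1,\ldots,Q_n$, each of order $n$ (the defining $n$-cliques), such that any two of them share at most one vertex, and such that every shared vertex (a vertex lying in more than one $Q_i$) belongs to exactly two defining $n$-cliques. Denote the shared vertex of $Q_i$ and $Q_j$, $i<j$ (when it exists), by $(i,j)$. Then: (i) If $n$ is even, then $$c\big((i,j)\big)\equiv\begin{cases} i+j \pmod{n-1} & \text{if } j<n,\\ 2i \pmod{n-1} & \text{if } j=n,\end{cases}$$ is a proper $(n-1)$-colouring of the shared vertices of $\mathcal{G}$. (ii) If $n$ is odd, then $c\big((i,j)\big)\equiv i+j\pmod{n}$ is a proper $n$-colouring of the shared vertices of $\mathcal{G}$. (iii) $\chi(\mathcal{G})=n$. (Here a colouring of the shared vertices is proper if any two shared vertices adjacent in $\mathcal{G}$ receive different colours.)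
   Context: Residues modulo $t$ are taken in the complete residue system $\{1,\ldots,t\}$. $\chi(\mathcal{G})$ denotes the chromatic number of $\mathcal{G}$. -}

module Defs where

open import Data.Nat using (ℕ; zero; suc; _+_; _*_; _<_; _≤_; _<ᵇ_)
open import Data.Nat.DivMod using (_mod_)
open import Data.Nat.Divisibility using (_∣_)
open import Data.Fin using (Fin; toℕ)
open import Data.Fin.Subset using (Subset; _∈_; ∣_∣)
open import Data.Product using (Σ; ∃; _×_; _,_)
open import Data.Sum using (_⊎_)
open import Data.Bool using (if_then_else_)
open import Relation.Nullary using (¬_)
open import Relation.Binary.PropositionalEquality using (_≡_; _≢_)

-- A family of n "defining cliques" on the vertex set Fin m:
-- Q i is the set of vertices of the i-th clique (indices i : Fin n stand for 1..n,
-- i.e. the paper's index is toℕ i + 1).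
Cliques : ℕ → ℕ → Set
Cliques n m = Fin n → Subset m

Adj : ∀ {n m} → Cliques n m → Fin m → Fin m → Set
Adj {n} Q u v = u ≢ v × ∃ λ (i : Fin n) → u ∈ Q i × v ∈ Q i

Covers : ∀ {n m} → Cliques n m → Set
Covers {n} {m} Q = (v : Fin m) → ∃ λ (i : Fin n) → v ∈ Q i

EachOrder : ∀ {n m} → Cliques n m → Set
EachOrder {n} Q = (i : Fin n) → ∣ Q i ∣ ≡ n

ShareAtMostOne : ∀ {n m} → Cliques n m → Set
ShareAtMostOne {n} {m} Q = (i j : Fin n) → i ≢ j → (u v : Fin m) →
  u ∈ Q i → u ∈ Q j → v ∈ Q i → v ∈ Q j → u ≡ v

SharedInExactlyTwo : ∀ {n m} → Cliques n m → Set
SharedInExactlyTwo {n} {m} Q = (v : Fin m) (i j : Fin n) → i ≢ j →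
  v ∈ Q i → v ∈ Q j → (k : Fin n) → v ∈ Q k → k ≡ i ⊎ k ≡ j

IsShared : ∀ {n m} → Cliques n m → Fin m → Fin n → Fin n → Set
IsShared Q v i j = toℕ i < toℕ j × v ∈ Q i × v ∈ Q j

ProperSharedColouring : ∀ {n m t} → Cliques n m → (Fin n → Fin n → Fin t) → Set
ProperSharedColouring {n} {m} Q c = (u v : Fin m) (i j k l : Fin n) →
  IsShared Q u i j → IsShared Q v k l → Adj Q u v → c i j ≢ c k l

-- 1-based index
idx : ∀ {n} → Fin n → ℕ
idx i = suc (toℕ i)

-- Colouring of part (i), n = 2 + r even, colours = residues mod n-1 = suc r.
-- c((i,j)) = i+j mod (n-1) if j < n, and 2i mod (n-1) if j = n.
colEven : (r : ℕ) → Fin (suc (suc r)) → Fin (suc (suc r)) → Fin (suc r)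
colEven r i j = if idx j <ᵇ suc (suc r)
                then (idx i + idx j) mod (suc r)
                else (2 * idx i) mod (suc r)

colOdd : (r : ℕ) → Fin (suc (suc r)) → Fin (suc (suc r)) → Fin (suc (suc r))
colOdd r i j = (idx i + idx j) mod (suc (suc r))

ProperColouring : ∀ {n m} → Cliques n m → (k : ℕ) → (Fin m → Fin k) → Set
ProperColouring {n} {m} Q k c = (u v : Fin m) → Adj Q u v → c u ≢ c v

ChromaticNumberIs : ∀ {n m} → Cliques n m → ℕ → Set
ChromaticNumberIs {n} {m} Q k =
  (Σ (Fin m → Fin k) λ c → ProperColouring Q k c) ×
  ((k' : ℕ) (c : Fin m → Fin k') → ProperColouring Q k' c → k ≤ k')

-- Two adjacent shared vertices (i,j) and (k,l) have a common defining clique, which is one of the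
-- two cliques of each, so the distinct index pairs {i,j} and {k,l} share an index. Properness of
-- both rules therefore reduces to cancellation modulo t: a + b ≡ a + b' forces b = b' when
-- |b - b'| < t, and for n even, 2a ≡ 2b forces a = b because t = n - 1 is odd. The rule i + j mod n
-- works for every n. An unshared vertex lies in exactly one defining clique, so it has only n - 1
-- neighbours, and colouring the unshared vertices greedily extends that rule to a proper n-colouring
-- of G; a defining clique shows that n colours are needed.

module Submission where

open import Defs
open import Data.Nat using (ℕ; suc)
open import Data.Nat.Divisibility using (_∣_)
open import Data.Product using (_×_)
open import Relation.Nullary using (¬_)

open import Data.Nat using (zero; _+_; _*_; _∸_; _<_; _≤_; _<ᵇ_; _%_; _/_; ∣_-_∣; NonZero; z≤n; s≤s; s≤s⁻¹)
open import Data.Nat.Properties as ℕ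
  using (≤-total; +-comm; +-identityʳ; *-distribʳ-∸; [m+n]∸[m+o]≡n∸o; ∣-∣-comm; ∣m+n-m+o∣≡∣n-o∣;
         *-distribˡ-∣-∣; ∣m-n∣≤m⊔n; ∣m-n∣≡0⇒m≡n; m≤n⇒∣m-n∣≡n∸m; ⊔-lub; <ᵇ⇒<; <⇒<ᵇ; m<1+n⇒m<n∨m≡n)
open import Data.Nat.DivMod using (_mod_; m≡m%n+[m/n]*n)
open import Data.Nat.Divisibility using (divides; ∣⇒≤; ∣m+n∣m⇒∣n; ∣1⇒≡1)
open import Data.Nat.Coprimality using (Coprime; coprime-divisor)
open import Data.Nat.Primality using (prime[2]; prime⇒irreducible)
open import Data.Fin as Fin using (Fin; toℕ; fromℕ<; _≟_)
open import Data.Fin.Properties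
  using (toℕ<n; toℕ-injective; toℕ-fromℕ<; suc-injective; 0≢1+n; <⇒≢; <-trans; <-cmp; any?; injective⇒≤)
open import Data.Fin.Subset using (Subset; _∈_; ∣_∣) renaming (_-_ to _∖_)
open import Data.Fin.Subset.Properties using (_∈?_; x∈p∧x≢y⇒x∈p-y; x∈p⇒∣p-x∣<∣p∣)
open import Data.Vec using (_∷_; here; there)
open import Data.Vec.Functional using (updateAt)
open import Data.Vec.Functional.Properties using (updateAt-updates; updateAt-minimal)
open import Data.Bool using (true; false; T)
open import Data.Unit using (tt)
open import Data.Empty using (⊥-elim)
open import Data.Product using (Σ; ∃-syntax; _,_; proj₁; proj₂)
open import Data.Sum using (_⊎_; inj₁; inj₂)
open import Function using (_∘_; const)
open import Function.Definitions using (Injective)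
open import Relation.Nullary using (Dec; yes; no; contradiction; ¬?)
open import Relation.Nullary.Decidable using (_×-dec_; _⊎-dec_; decidable-stable)
open import Relation.Binary using (tri<; tri≈; tri>)
open import Relation.Binary.PropositionalEquality
  using (_≡_; _≢_; refl; sym; trans; cong; cong₂; subst; module ≡-Reasoning)

m%d≡n%d⇒d∣n∸m : ∀ {m n} d .{{_ : NonZero d}} → m ≤ n → m % d ≡ n % d → d ∣ n ∸ m
m%d≡n%d⇒d∣n∸m {m} {n} d m≤n eq = divides (n / d ∸ m / d) (begin
    n ∸ m                                     ≡⟨ cong₂ _∸_ (m≡m%n+[m/n]*n n d) (m≡m%n+[m/n]*n m d) ⟩
    (n % d + n / d * d) ∸ (m % d + m / d * d) ≡⟨ cong (λ z → (n % d + n / d * d) ∸ (z + m / d * d)) eq ⟩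
    (n % d + n / d * d) ∸ (n % d + m / d * d) ≡⟨ [m+n]∸[m+o]≡n∸o (n % d) _ _ ⟩
    n / d * d ∸ m / d * d                     ≡⟨ *-distribʳ-∸ d (n / d) (m / d) ⟨
    (n / d ∸ m / d) * d                       ∎)
  where open ≡-Reasoning

m%d≡n%d⇒d∣∣m-n∣ : ∀ m n d .{{_ : NonZero d}} → m % d ≡ n % d → d ∣ ∣ m - n ∣
m%d≡n%d⇒d∣∣m-n∣ m n d eq with ≤-total m n
... | inj₁ m≤n = subst (d ∣_) (sym (m≤n⇒∣m-n∣≡n∸m m≤n)) (m%d≡n%d⇒d∣n∸m d m≤n eq)
... | inj₂ n≤m = subst (d ∣_) (sym (trans (∣-∣-comm m n) (m≤n⇒∣m-n∣≡n∸m n≤m))) (m%d≡n%d⇒d∣n∸m d n≤m (sym eq))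

m∣n∧n<m⇒n≡0 : ∀ {m n} → m ∣ n → n < m → n ≡ 0
m∣n∧n<m⇒n≡0 {n = zero}  _   _   = refl
m∣n∧n<m⇒n≡0 {n = suc n} m∣n n<m = contradiction (∣⇒≤ m∣n) (ℕ.<⇒≱ n<m)

m<o∧n<o⇒∣m-n∣<o : ∀ {m n o} → m < o → n < o → ∣ m - n ∣ < o
m<o∧n<o⇒∣m-n∣<o {m} {n} m<o n<o = ℕ.≤-<-trans (∣m-n∣≤m⊔n m n) (⊔-lub m<o n<o)

+-cancelˡ-% : ∀ c {a b} d .{{_ : NonZero d}} → ∣ a - b ∣ < d → (c + a) % d ≡ (c + b) % d → a ≡ b
+-cancelˡ-% c {a} {b} d close eq = ∣m-n∣≡0⇒m≡n (m∣n∧n<m⇒n≡0 d∣∣a-b∣ close)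
  where
  d∣∣a-b∣ : d ∣ ∣ a - b ∣
  d∣∣a-b∣ = subst (d ∣_) (∣m+n-m+o∣≡∣n-o∣ c a b) (m%d≡n%d⇒d∣∣m-n∣ (c + a) (c + b) d eq)

*-cancelˡ-% : ∀ c {a b} d .{{_ : NonZero d}} → Coprime d c → ∣ a - b ∣ < d → (c * a) % d ≡ (c * b) % d → a ≡ b
*-cancelˡ-% c {a} {b} d coprime close eq =
  ∣m-n∣≡0⇒m≡n (m∣n∧n<m⇒n≡0 (coprime-divisor coprime d∣c*∣a-b∣) close)
  where
  d∣c*∣a-b∣ : d ∣ c * ∣ a - b ∣
  d∣c*∣a-b∣ = subst (d ∣_) (sym (*-distribˡ-∣-∣ c a b)) (m%d≡n%d⇒d∣∣m-n∣ (c * a) (c * b) d eq)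

2∤⇒coprime-2 : ∀ {d} → ¬ 2 ∣ d → Coprime d 2
2∤⇒coprime-2 2∤d (e∣d , e∣2) with prime⇒irreducible prime[2] e∣2
... | inj₁ e≡1  = e≡1
... | inj₂ refl = contradiction e∣d 2∤d

2∣1+n⇒2∤n : ∀ {n} → 2 ∣ suc n → ¬ 2 ∣ n
2∣1+n⇒2∤n {n} 2∣1+n 2∣n = contradiction (∣1⇒≡1 (∣m+n∣m⇒∣n 2∣n+1 2∣n)) λ ()
  where
  2∣n+1 : 2 ∣ n + 1
  2∣n+1 = subst (2 ∣_) (+-comm 1 n) 2∣1+n

enum : ∀ {m} (p : Subset m) → Fin ∣ p ∣ → Fin m
enum (true  ∷ p) Fin.zero    = Fin.zero
enum (true  ∷ p) (Fin.suc x) = Fin.suc (enum p x)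
enum (false ∷ p) x           = Fin.suc (enum p x)

enum-∈ : ∀ {m} (p : Subset m) x → enum p x ∈ p
enum-∈ (true  ∷ p) Fin.zero    = here
enum-∈ (true  ∷ p) (Fin.suc x) = there (enum-∈ p x)
enum-∈ (false ∷ p) x           = there (enum-∈ p x)

enum-injective : ∀ {m} (p : Subset m) → Injective _≡_ _≡_ (enum p)
enum-injective (true  ∷ p) {Fin.zero}  {Fin.zero}  _  = refl
enum-injective (true  ∷ p) {Fin.suc x} {Fin.suc y} eq = cong Fin.suc (enum-injective p (suc-injective eq))
enum-injective (false ∷ p)                         eq = enum-injective p (suc-injective eq)

injection⇒≤∣p∣ : ∀ {a m} (p : Subset m) (f : Fin a → Fin m) →
                 Injective _≡_ _≡_ f → (∀ x → f x ∈ p) → a ≤ ∣ p ∣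
injection⇒≤∣p∣ {zero}  p f f-inj f∈p = z≤n
injection⇒≤∣p∣ {suc a} p f f-inj f∈p =
  ℕ.≤-trans (s≤s (injection⇒≤∣p∣ (p ∖ f Fin.zero) (f ∘ Fin.suc) (suc-injective ∘ f-inj) f∘suc∈))
            (x∈p⇒∣p-x∣<∣p∣ (f∈p Fin.zero))
  where
  f∘suc∈ : ∀ x → f (Fin.suc x) ∈ p ∖ f Fin.zero
  f∘suc∈ x = x∈p∧x≢y⇒x∈p-y (f∈p (Fin.suc x)) (λ eq → 0≢1+n (sym (f-inj eq)))

module GreedyColouring {m : ℕ} (E : Fin m → Fin m → Set) (E? : ∀ u w → Dec (E u w))
                       (E-sym : ∀ {u w} → E u w → E w u) (E-irrefl : ∀ {v} → ¬ E v v) (k : ℕ) where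

  ProperOn : (Fin m → Set) → (Fin m → Fin k) → Set
  ProperOn D c = ∀ {u w} → D u → D w → E u w → c u ≢ c w

  FewerNeighbours : Fin m → Set
  FewerNeighbours v = (g : Fin k → Fin m) → Injective _≡_ _≡_ g → ¬ (∀ x → E v (g x))

  ProperOn-⊆ : ∀ {D D′ c} → (∀ {w} → D′ w → D w) → ProperOn D c → ProperOn D′ c
  ProperOn-⊆ D′⊆D proper D′u D′w = proper (D′⊆D D′u) (D′⊆D D′w)

  UsedAround : (Fin m → Set) → (Fin m → Fin k) → Fin m → Fin k → Set
  UsedAround D c v x = ∃[ w ] (D w × E v w × c w ≡ x)

  usedAround? : {D : Fin m → Set} → (∀ w → Dec (D w)) → ∀ c v x → Dec (UsedAround D c v x)
  usedAround? D? c v x = any? (λ w → D? w ×-dec E? v w ×-dec c w ≟ x)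

  free-colour : {D : Fin m → Set} → (∀ w → Dec (D w)) → (c : Fin m → Fin k) → ∀ {v} → FewerNeighbours v →
                ∃[ x ] ¬ UsedAround D c v x
  free-colour D? c {v} few with any? (¬? ∘ usedAround? D? c v)
  ... | yes free = free
  ... | no everyColourUsed = ⊥-elim (few user user-injective user-adjacent)
    where
    used : ∀ x → UsedAround _ c v x
    used x = decidable-stable (usedAround? D? c v x) (λ unused → everyColourUsed (x , unused))
    user : Fin k → Fin m
    user x = proj₁ (used x)
    user-adjacent : ∀ x → E v (user x)
    user-adjacent x = proj₁ (proj₂ (proj₂ (used x)))
    colour-of-user : ∀ x → c (user x) ≡ x
    colour-of-user x = proj₂ (proj₂ (proj₂ (used x)))
    user-injective : Injective _≡_ _≡_ user
    user-injective {x} {y} eq = trans (sym (colour-of-user x)) (trans (cong c eq) (colour-of-user y))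

  extend : {D : Fin m → Set} → (∀ w → Dec (D w)) → (c : Fin m → Fin k) → ProperOn D c →
           ∀ {v} → FewerNeighbours v → ∃[ c′ ] ProperOn (λ w → D w ⊎ w ≡ v) c′
  extend {D} D? c c-proper {v} few = c′ , c′-proper
    where
    x : Fin k
    x = proj₁ (free-colour D? c few)
    x-free : ¬ UsedAround D c v x
    x-free = proj₂ (free-colour D? c few)
    c′ : Fin m → Fin k
    c′ = updateAt c v (const x)
    c′-at-v : c′ v ≡ x
    c′-at-v = updateAt-updates v c
    c′-elsewhere : ∀ {w} → w ≢ v → c′ w ≡ c w
    c′-elsewhere {w} w≢v = updateAt-minimal w v c w≢v
    in-D : ∀ {w} → D w ⊎ w ≡ v → w ≢ v → D w
    in-D (inj₁ Dw) _ = Dw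
    in-D (inj₂ w≡v) w≢v = contradiction w≡v w≢v
    clash-at-v : ∀ {w} → D w → E v w → c′ v ≢ c′ w
    clash-at-v {w} Dw Evw eq = x-free (w , Dw , Evw , trans (sym (c′-elsewhere w≢v)) (trans (sym eq) c′-at-v))
      where
      w≢v : w ≢ v
      w≢v refl = E-irrefl Evw
    c′-proper : ProperOn (λ w → D w ⊎ w ≡ v) c′
    c′-proper {u} {w} Du Dw Euw with u ≟ v | w ≟ v
    ... | yes refl | yes refl = contradiction Euw E-irrefl
    ... | yes refl | no w≢v = clash-at-v (in-D Dw w≢v) Euw
    ... | no u≢v | yes refl = clash-at-v (in-D Du u≢v) (E-sym Euw) ∘ sym
    ... | no u≢v | no w≢v = λ eq → c-proper (in-D Du u≢v) (in-D Dw w≢v) Euw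
                                     (trans (sym (c′-elsewhere u≢v)) (trans eq (c′-elsewhere w≢v)))

  greedy : (S : Fin m → Set) → (∀ w → Dec (S w)) → (c₀ : Fin m → Fin k) → ProperOn S c₀ →
           (∀ {v} → ¬ S v → FewerNeighbours v) → ∃[ c ] (∀ u w → E u w → c u ≢ c w)
  greedy S S? c₀ c₀-proper few = c , λ u w → c-proper (inj₂ (toℕ<n u)) (inj₂ (toℕ<n w))
    where
    Done : ℕ → Fin m → Set
    Done t w = S w ⊎ toℕ w < t
    done? : ∀ t w → Dec (Done t w)
    done? t w = S? w ⊎-dec toℕ w ℕ.<? t
    Done-suc : ∀ {t v w} → toℕ v ≡ t → Done (suc t) w → Done t w ⊎ w ≡ v
    Done-suc _   (inj₁ Sw) = inj₁ (inj₁ Sw)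
    Done-suc v≡t (inj₂ w<1+t) with m<1+n⇒m<n∨m≡n w<1+t
    ... | inj₁ w<t = inj₁ (inj₂ w<t)
    ... | inj₂ w≡t = inj₂ (toℕ-injective (trans w≡t (sym v≡t)))
    proper-upto : ∀ t → t ≤ m → ∃[ c ] ProperOn (Done t) c
    proper-upto zero    _   = c₀ , ProperOn-⊆ (λ { (inj₁ Sw) → Sw ; (inj₂ ()) }) c₀-proper
    proper-upto (suc t) t<m with proper-upto t (ℕ.<⇒≤ t<m) | S? (fromℕ< t<m)
    ... | c , c-proper | yes Sv = c , ProperOn-⊆ done-earlier c-proper
      where
      done-earlier : ∀ {w} → Done (suc t) w → Done t w
      done-earlier Dw with Done-suc (toℕ-fromℕ< t<m) Dw
      ... | inj₁ Dw′  = Dw′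
      ... | inj₂ refl = inj₁ Sv
    ... | c , c-proper | no ¬Sv with extend (done? t) c c-proper (few ¬Sv)
    ...   | c′ , c′-proper = c′ , ProperOn-⊆ (Done-suc (toℕ-fromℕ< t<m)) c′-proper
    c : Fin m → Fin k
    c = proj₁ (proper-upto m ℕ.≤-refl)
    c-proper : ProperOn (Done m) c
    c-proper = proj₂ (proper-upto m ℕ.≤-refl)

-- The index pairs {i,j} and {k,l} are distinct but intersect; the subscripts name the positions that coincide.
data Meet {n : ℕ} : Fin n → Fin n → Fin n → Fin n → Set where
  share₁₁ : ∀ {i j l} → j ≢ l → Meet i j i l
  share₁₂ : ∀ {i j k} → Meet i j k i
  share₂₁ : ∀ {i j l} → Meet i j j l
  share₂₂ : ∀ {i j k} → i ≢ k → Meet i j k j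

Separates : ∀ {n t} → (Fin n → Fin n → Fin t) → Set
Separates c = ∀ {i j k l} → i Fin.< j → k Fin.< l → Meet i j k l → c i j ≢ c k l

sumColour : ∀ {n} t .{{_ : NonZero t}} → Fin n → Fin n → Fin t
sumColour t i j = (idx i + idx j) mod t

doubleColour : ∀ {n} t .{{_ : NonZero t}} → Fin n → Fin t
doubleColour t i = (2 * idx i) mod t

mod-≡⇒%-≡ : ∀ {x y} t .{{_ : NonZero t}} → x mod t ≡ y mod t → x % t ≡ y % t
mod-≡⇒%-≡ t eq = trans (sym (toℕ-fromℕ< _)) (trans (cong toℕ eq) (toℕ-fromℕ< _))

idx-injective : ∀ {n} → Injective _≡_ _≡_ (idx {n})
idx-injective = toℕ-injective ∘ ℕ.suc-injective

sumColour-comm : ∀ {n} t .{{_ : NonZero t}} (i j : Fin n) → sumColour t i j ≡ sumColour t j i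
sumColour-comm t i j = cong (_mod t) (+-comm (idx i) (idx j))

sumColour-cancelˡ : ∀ {n} t .{{_ : NonZero t}} (i : Fin n) {j l} →
                    toℕ j < t → toℕ l < t → sumColour t i j ≡ sumColour t i l → j ≡ l
sumColour-cancelˡ t i j<t l<t eq =
  idx-injective (+-cancelˡ-% (idx i) t (m<o∧n<o⇒∣m-n∣<o j<t l<t) (mod-≡⇒%-≡ t eq))

doubleColour≡sumColour : ∀ {n} t .{{_ : NonZero t}} (i : Fin n) → doubleColour t i ≡ sumColour t i i
doubleColour≡sumColour t i = cong (λ z → (idx i + z) mod t) (+-identityʳ (idx i))

doubleColour-cancel : ∀ {n} t .{{_ : NonZero t}} → Coprime t 2 → {i k : Fin n} →
                      toℕ i < t → toℕ k < t → doubleColour t i ≡ doubleColour t k → i ≡ k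
doubleColour-cancel t coprime i<t k<t eq =
  idx-injective (*-cancelˡ-% 2 t coprime (m<o∧n<o⇒∣m-n∣<o i<t k<t) (mod-≡⇒%-≡ t eq))

sumColour-separates : ∀ {n} .{{_ : NonZero n}} → Separates (sumColour {n} n)
sumColour-separates {n} {j = j} {l = l} _ _ (share₁₁ j≢l) =
  j≢l ∘ sumColour-cancelˡ n _ (toℕ<n j) (toℕ<n l)
sumColour-separates {n} {i} {j} {k} i<j k<i share₁₂ eq =
  <⇒≢ (<-trans k<i i<j) (sym (sumColour-cancelˡ n i (toℕ<n j) (toℕ<n k) (trans eq (sumColour-comm n k i))))
sumColour-separates {n} {i} {j} {l = l} i<j j<l share₂₁ eq =
  <⇒≢ (<-trans i<j j<l) (sumColour-cancelˡ n j (toℕ<n i) (toℕ<n l) (trans (sumColour-comm n j i) eq))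
sumColour-separates {n} {i} {j} {k} _ _ (share₂₂ i≢k) eq =
  i≢k (sumColour-cancelˡ n j (toℕ<n i) (toℕ<n k) (trans (sumColour-comm n j i) (trans eq (sumColour-comm n k j))))

module _ (r : ℕ) where

  colEven-inner : ∀ {i j} → toℕ j < suc r → colEven r i j ≡ sumColour (suc r) i j
  colEven-inner {i} {j} j<1+r with toℕ j <ᵇ suc r in lt
  ... | true  = refl
  ... | false = ⊥-elim (subst T lt (<⇒<ᵇ j<1+r))

  colEven-top : ∀ {i j} → toℕ j ≡ suc r → colEven r i j ≡ doubleColour (suc r) i
  colEven-top {i} {j} j≡1+r with toℕ j <ᵇ suc r in lt
  ... | true  = contradiction (<ᵇ⇒< _ _ (subst T (sym lt) tt)) (ℕ.<-irrefl j≡1+r)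
  ... | false = refl

  inner-or-top : (j : Fin (suc (suc r))) → toℕ j < suc r ⊎ toℕ j ≡ suc r
  inner-or-top j = m<1+n⇒m<n∨m≡n (toℕ<n j)

  below-top : {i j : Fin (suc (suc r))} → i Fin.< j → toℕ i < suc r
  below-top {j = j} i<j = ℕ.<-≤-trans i<j (s≤s⁻¹ (toℕ<n j))

  colEven-separates : 2 ∣ suc (suc r) → Separates (colEven r)
  colEven-separates 2∣n {i} {j} {k} {l} i<j k<l (share₁₁ j≢l) with inner-or-top j | inner-or-top l
  ... | inj₁ j< | inj₁ l< rewrite colEven-inner {i} j< | colEven-inner {i} l< =
    j≢l ∘ sumColour-cancelˡ (suc r) i j< l<
  ... | inj₂ j⊤ | inj₁ l< rewrite colEven-top {i} j⊤ | colEven-inner {i} l< = λ eq →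
    <⇒≢ k<l (sumColour-cancelˡ (suc r) i (below-top i<j) l< (trans (sym (doubleColour≡sumColour (suc r) i)) eq))
  ... | inj₁ j< | inj₂ l⊤ rewrite colEven-inner {i} j< | colEven-top {i} l⊤ = λ eq →
    <⇒≢ i<j (sym (sumColour-cancelˡ (suc r) i j< (below-top i<j) (trans eq (doubleColour≡sumColour (suc r) i))))
  ... | inj₂ j⊤ | inj₂ l⊤ = λ _ → j≢l (toℕ-injective (trans j⊤ (sym l⊤)))
  colEven-separates 2∣n {i} {j} {k} i<j k<i share₁₂ with inner-or-top j
  ... | inj₁ j< rewrite colEven-inner {i} j< | colEven-inner {k} (below-top i<j) = λ eq →
    <⇒≢ (<-trans k<i i<j)
        (sym (sumColour-cancelˡ (suc r) i j< (below-top k<i) (trans eq (sumColour-comm (suc r) k i))))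
  ... | inj₂ j⊤ rewrite colEven-top {i} j⊤ | colEven-inner {k} (below-top i<j) = λ eq →
    <⇒≢ k<i (sym (sumColour-cancelˡ (suc r) i (below-top i<j) (below-top k<i)
                    (trans (sym (doubleColour≡sumColour (suc r) i)) (trans eq (sumColour-comm (suc r) k i)))))
  colEven-separates 2∣n {i} {j} {l = l} i<j j<l share₂₁ with inner-or-top l
  ... | inj₁ l< rewrite colEven-inner {i} (below-top j<l) | colEven-inner {j} l< = λ eq →
    <⇒≢ (<-trans i<j j<l)
        (sumColour-cancelˡ (suc r) j (below-top i<j) l< (trans (sumColour-comm (suc r) j i) eq))
  ... | inj₂ l⊤ rewrite colEven-inner {i} (below-top j<l) | colEven-top {j} l⊤ = λ eq →
    <⇒≢ i<j (sumColour-cancelˡ (suc r) j (below-top i<j) (below-top j<l)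
               (trans (sumColour-comm (suc r) j i) (trans eq (doubleColour≡sumColour (suc r) j))))
  colEven-separates 2∣n {i} {j} {k} i<j k<j (share₂₂ i≢k) with inner-or-top j
  ... | inj₁ j< rewrite colEven-inner {i} j< | colEven-inner {k} j< = λ eq →
    i≢k (sumColour-cancelˡ (suc r) j (below-top i<j) (below-top k<j)
           (trans (sumColour-comm (suc r) j i) (trans eq (sumColour-comm (suc r) k j))))
  ... | inj₂ j⊤ rewrite colEven-top {i} j⊤ | colEven-top {k} j⊤ =
    i≢k ∘ doubleColour-cancel (suc r) (2∤⇒coprime-2 (2∣1+n⇒2∤n 2∣n)) (below-top i<j) (below-top k<j)

module _ {n m : ℕ} (Q : Cliques n m) where

  Shared : Fin m → Set
  Shared w = ∃[ i ] ∃[ j ] IsShared Q w i j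

  shared? : ∀ w → Dec (Shared w)
  shared? w = any? λ i → any? λ j → toℕ i ℕ.<? toℕ j ×-dec w ∈? Q i ×-dec w ∈? Q j

  adjacent? : ∀ u v → Dec (Adj Q u v)
  adjacent? u v = ¬? (u ≟ v) ×-dec any? λ i → u ∈? Q i ×-dec v ∈? Q i

  adjacent-sym : ∀ {u v} → Adj Q u v → Adj Q v u
  adjacent-sym (u≢v , i , u∈ , v∈) = u≢v ∘ sym , i , v∈ , u∈

  adjacent-irrefl : ∀ {v} → ¬ Adj Q v v
  adjacent-irrefl (v≢v , _) = v≢v refl

  open GreedyColouring (Adj Q) adjacent? adjacent-sym adjacent-irrefl n using (FewerNeighbours)

  shared-adjacent⇒meet : ShareAtMostOne Q → SharedInExactlyTwo Q → ∀ {u v i j k l} →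
                         IsShared Q u i j → IsShared Q v k l → Adj Q u v → Meet i j k l
  shared-adjacent⇒meet atMostOne exactlyTwo {u} {v} {i} {j}
                       (i<j , u∈i , u∈j) (k<l , v∈k , v∈l) (u≢v , a , u∈a , v∈a)
    with exactlyTwo u i j (<⇒≢ i<j) u∈i u∈j a u∈a | exactlyTwo v _ _ (<⇒≢ k<l) v∈k v∈l a v∈a
  ... | inj₁ refl | inj₁ refl = share₁₁ λ { refl → u≢v (atMostOne i j (<⇒≢ i<j) u v u∈i u∈j v∈k v∈l) }
  ... | inj₁ refl | inj₂ refl = share₁₂
  ... | inj₂ refl | inj₁ refl = share₂₁
  ... | inj₂ refl | inj₂ refl = share₂₂ λ { refl → u≢v (atMostOne i j (<⇒≢ i<j) u v u∈i u∈j v∈k v∈l) }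

  separates⇒proper : ShareAtMostOne Q → SharedInExactlyTwo Q → ∀ {t} {c : Fin n → Fin n → Fin t} →
                     Separates c → ProperSharedColouring Q c
  separates⇒proper atMostOne exactlyTwo separates u v i j k l su@(i<j , _) sv@(k<l , _) adj =
    separates i<j k<l (shared-adjacent⇒meet atMostOne exactlyTwo su sv adj)

  clique-order≤colours : ∀ {k} (c : Fin m → Fin k) → ProperColouring Q k c → ∀ i → ∣ Q i ∣ ≤ k
  clique-order≤colours c proper i = injective⇒≤ {f = c ∘ enum (Q i)} injective
    where
    injective : Injective _≡_ _≡_ (c ∘ enum (Q i))
    injective {x} {y} eq with enum (Q i) x ≟ enum (Q i) y
    ... | yes same = enum-injective (Q i) same
    ... | no different = contradiction eq (proper _ _ (different , i , enum-∈ (Q i) x , enum-∈ (Q i) y))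

  unshared⇒unique-clique : ∀ {v a b} → ¬ Shared v → v ∈ Q a → v ∈ Q b → a ≡ b
  unshared⇒unique-clique {a = a} {b} unshared v∈a v∈b with <-cmp a b
  ... | tri< a<b _ _ = contradiction (a , b , a<b , v∈a , v∈b) unshared
  ... | tri≈ _ a≡b _ = a≡b
  ... | tri> _ _ b<a = contradiction (b , a , b<a , v∈b , v∈a) unshared

  -- The neighbours of v all lie in Q a ∖ v, where Q a is the only defining clique containing v.
  unshared⇒fewer-neighbours : Covers Q → EachOrder Q → ∀ {v} → ¬ Shared v → FewerNeighbours v
  unshared⇒fewer-neighbours cover order {v} unshared g g-injective adjacent =
    ℕ.<⇒≢ (ℕ.≤-<-trans (injection⇒≤∣p∣ (Q a ∖ v) g g-injective g∈) (x∈p⇒∣p-x∣<∣p∣ v∈a)) (sym (order a))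
    where
    a : Fin n
    a = proj₁ (cover v)
    v∈a : v ∈ Q a
    v∈a = proj₂ (cover v)
    g∈ : ∀ x → g x ∈ Q a ∖ v
    g∈ x with adjacent x
    ... | v≢gx , b , v∈b , gx∈b =
      x∈p∧x≢y⇒x∈p-y (subst (λ b → g x ∈ Q b) (unshared⇒unique-clique unshared v∈b v∈a) gx∈b) (v≢gx ∘ sym)

colourable : ∀ {n m} (Q : Cliques (suc n) m) → Covers Q → EachOrder Q → ShareAtMostOne Q → SharedInExactlyTwo Q →
             Σ (Fin m → Fin (suc n)) (ProperColouring Q (suc n))
colourable {n} {m} Q cover order atMostOne exactlyTwo =
  greedy (Shared Q) (shared? Q) c₀ c₀-proper (unshared⇒fewer-neighbours Q cover order)
  where
  open GreedyColouring (Adj Q) (adjacent? Q) (adjacent-sym Q) (adjacent-irrefl Q) (suc n)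
  -- c₀ only matters on shared vertices: greedy recolours all the others.
  c₀ : Fin m → Fin (suc n)
  c₀ w with shared? Q w
  ... | yes (i , j , _) = sumColour (suc n) i j
  ... | no _ = Fin.zero
  c₀-proper : ProperOn (Shared Q) c₀
  c₀-proper {u} {w} Su Sw with shared? Q u | shared? Q w
  ... | yes (i , j , su) | yes (k , l , sw) =
    separates⇒proper Q atMostOne exactlyTwo sumColour-separates u w i j k l su sw
  ... | no unshared | _ = contradiction Su unshared
  ... | yes _ | no unshared = contradiction Sw unshared

theorem2p4 : (r m : ℕ) (Q : Cliques (suc (suc r)) m) →
    Covers Q → EachOrder Q → ShareAtMostOne Q → SharedInExactlyTwo Q →
      (2 ∣ suc (suc r) → ProperSharedColouring Q (colEven r)) ×
      (¬ 2 ∣ suc (suc r) → ProperSharedColouring Q (colOdd r)) ×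
      ChromaticNumberIs Q (suc (suc r))
theorem2p4 r m Q cover order atMostOne exactlyTwo =
    (λ 2∣n → separates⇒proper Q atMostOne exactlyTwo (colEven-separates r 2∣n))
  , (λ _ → separates⇒proper Q atMostOne exactlyTwo sumColour-separates)
  , colourable Q cover order atMostOne exactlyTwo
  , λ k c proper → subst (_≤ k) (order Fin.zero) (clique-order≤colours Q c proper Fin.zero)
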